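{- Let $G$ be a finite simple graph with maximum degree $\Delta$. Then $\iota(\mathrm{Mid}(G))\le \Delta\,\iota(G)$. Moreover, the bound is sharp: for every $k\ge 1$, $G=K_{k,k}$ satisfies $\iota(\mathrm{Mid}(G))=\Delta(G)\,\iota(G)$.
   Context: For a graph $H$ and $S\subseteq V(H)$, let $N_H[S]$ be $S$ together with all vertices adjacent to a vertex of $S$. A set $S\subseteq V(H)$ is an isolating set of $H$ if $V(H)\setminus N_H[S]$ is an independent set of $H$; $\iota(H)$ is the minimum size of an isolating set of $H$. The middle graph $\mathrm{Mid}(G)$ has vertex set $V(G)\cup\{m_e: e\in E(G)\}$, with $v\sim m_e$ iff $v$ is an endpoint of $e$, $m_e\sim m_f$ iff distinct edges $e,f$ share an endpoint, and no edges between vertices of $V(G)$. -}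

module Defs where

open import Data.Nat using (ℕ; _+_; _*_; _≤_; _<ᵇ_; _⊔_)
open import Data.Bool using (Bool; true; false; _∧_; _∨_; not; if_then_else_)
open import Data.Fin using (Fin; toℕ; splitAt)
open import Data.Fin.Properties using (_≟_)
open import Data.Fin.Subset using (Subset; _∈_; _∉_; ∣_∣)
open import Data.List as List using (List; allFin; filterᵇ; cartesianProduct; length; lookup)
open import Data.Vec using (tabulate)
open import Data.Product using (_×_; _,_; proj₁; proj₂; ∃; ∃-syntax)
open import Data.Sum using (inj₁; inj₂)
open import Relation.Nullary.Decidable using (⌊_⌋)
open import Relation.Binary.PropositionalEquality using (_≡_)

record Graph : Set where
  field
    n   : ℕ
    adj : Fin n → Fin n → Bool
open Graph public

IsSimple : Graph → Set
IsSimple G = (∀ u v → adj G u v ≡ adj G v u) × (∀ v → adj G v v ≡ false)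

degree : (G : Graph) → Fin (n G) → ℕ
degree G v = ∣ tabulate (adj G v) ∣

maxDegree : Graph → ℕ
maxDegree G = List.foldr _⊔_ 0 (List.map (degree G) (allFin (n G)))

_∈N[_]_ : (H : Graph) → Subset (n H) → Fin (n H) → Set
H ∈N[ S ] u = u ∈ S ⊎' (∃[ s ] (s ∈ S × adj H s u ≡ true))
  where
  open import Data.Sum renaming (_⊎_ to _⊎'_)

IsIsolating : (H : Graph) → Subset (n H) → Set
IsIsolating H S = ∀ u v → ¬' (H ∈N[ S ] u) → ¬' (H ∈N[ S ] v) → adj H u v ≡ false
  where
  open import Relation.Nullary renaming (¬_ to ¬'_)

IsIota : Graph → ℕ → Set
IsIota H k = (∃[ S ] (IsIsolating H S × ∣ S ∣ ≡ k))
           × (∀ S → IsIsolating H S → k ≤ ∣ S ∣)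

edges : (G : Graph) → List (Fin (n G) × Fin (n G))
edges G = filterᵇ (λ p → (toℕ (proj₁ p) <ᵇ toℕ (proj₂ p)) ∧ adj G (proj₁ p) (proj₂ p))
                  (cartesianProduct (allFin (n G)) (allFin (n G)))

-- middle graph: vertices are V(G) (first n G) followed by one vertex m_e per edge e
Mid : Graph → Graph
Mid G = record { n = n G + length E ; adj = madj }
  where
  E = edges G
  endpoint : Fin (n G) → Fin (length E) → Bool
  endpoint v e = ⌊ v ≟ proj₁ (lookup E e) ⌋ ∨ ⌊ v ≟ proj₂ (lookup E e) ⌋
  share : Fin (length E) → Fin (length E) → Bool
  share e f = endpoint (proj₁ (lookup E e)) f ∨ endpoint (proj₂ (lookup E e)) f
  madj : Fin (n G + length E) → Fin (n G + length E) → Bool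
  madj x y with splitAt (n G) x | splitAt (n G) y
  ... | inj₁ _ | inj₁ _ = false
  ... | inj₁ v | inj₂ e = endpoint v e
  ... | inj₂ e | inj₁ v = endpoint v e
  ... | inj₂ e | inj₂ f = not ⌊ e ≟ f ⌋ ∧ share e f

-- complete bipartite graph K_{k,k}: vertices 0..k-1 form one side, k..2k-1 the other
K : ℕ → Graph
K k = record { n = k + k ; adj = λ u v → side u xor side v }
  where
  open import Data.Bool using (_xor_)
  side : Fin (k + k) → Bool
  side u = toℕ u <ᵇ k

-- If S isolates G, so does the set of middle vertices m_e of the edges e meeting S in Mid(G):
-- the original vertices are pairwise non-adjacent there, and an edge e with no end in S has an
-- end t adjacent to some s ∈ S, making m_e adjacent to m_st. Counting each such edge at its ends
-- in S, there are at most Σ_{v ∈ S} deg v ≤ Δ |S| of them.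
--
-- In K_{k,k} one vertex isolates, so ι = 1 and Δ = k. Conversely let S isolate Mid(K_{k,k}),
-- with sides a_1 … a_k and b_1 … b_k; give m_{a b} the left end a and right end b, and a vertex
-- itself as both ends. If some a_i is the left end of no element of S and some b_j the right end
-- of none, then a_i and m_{a_i b_j} are adjacent and both undominated. So S has k elements with
-- distinct left ends or k elements with distinct right ends.

module Submission where

open import Defs
open import Data.Bool using (Bool; true; false; _∧_; _∨_; _xor_; not; T)
import Data.Bool.Properties as Boolₚ
open import Data.Bool.Properties using (T-∧; T-∨; T-≡; ∨-zeroʳ; xor-comm; xor-same)
open import Data.Empty using (⊥; ⊥-elim)
open import Data.Sum using (_⊎_; inj₁; inj₂; [_,_]; [_,_]′)
open import Data.Unit using (tt)
open import Data.Fin as Fin using (Fin; toℕ; splitAt; _↑ˡ_; _↑ʳ_)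
import Data.Fin.Properties as Finₚ
open Finₚ using (_≟_; any?; all?; ¬∀⟶∃¬)
open import Data.Fin.Subset using (Subset; _∈_; _∉_; ∣_∣; _-_; ⁅_⁆)
open import Data.Fin.Subset.Properties
  using (x∈p∧x≢y⇒x∈p-y; x∈p⇒∣p-x∣<∣p∣; _∈?_; x∈⁅x⁆; ∣⁅x⁆∣≡1)
open import Data.List as List using (List; []; _∷_; allFin; filterᵇ; cartesianProduct; length; lookup)
open import Data.List.Properties
  using (map-++; map-∘; map-tabulate; foldr-preservesᵇ; foldr-preservesᵒ)
open import Data.List.Membership.Propositional.Properties
  using (∈-filter⁺; ∈-filter⁻; ∈-lookup; ∈-cartesianProduct⁺; ∈-allFin; ∈-map⁺)
open import Data.List.Relation.Unary.All.Properties as All using (tabulate⁺)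
import Data.List.Relation.Unary.Any as Any
open import Data.List.Relation.Unary.Any.Properties using (lookup-index)
open import Data.Nat using (ℕ; zero; suc; _+_; _*_; _≤_; _<_; _≥_; _<ᵇ_; _⊔_; z≤n; s≤s)
open import Data.Nat.ListAction as ListAction using ()
open import Data.Nat.ListAction.Properties using (sum-++)
open import Data.Nat.Properties hiding (_≟_)
open import Algebra.Properties.Semiring.Sum +-*-semiring
  using (sum; sum-syntax; sum-cong-≗; ∑-distrib-+; ∑-comm; *-distribˡ-sum; *-distribʳ-sum)
open import Data.Product using (_×_; _,_; proj₁; proj₂; ∃-syntax)
open import Data.Vec as Vec using (tabulate)
open import Data.Vec.Properties using (lookup∘tabulate; tabulate∘lookup; lookup⇒[]=; []=⇒lookup)
open import Function using (_∘_; id; Equivalence)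
open import Function.Definitions using (Injective)
open import Relation.Nullary using (¬_; Dec; contradiction; yes; no)
open import Relation.Binary.Definitions using (tri<; tri≈; tri>)
open import Relation.Nullary.Decidable using (T?; ⌊_⌋; _⊎-dec_; _×-dec_)
open import Relation.Binary.PropositionalEquality hiding ([_])

𝟙 : Bool → ℕ
𝟙 true  = 1
𝟙 false = 0

𝟙-∨ : ∀ a b → 𝟙 (a ∨ b) ≤ 𝟙 a + 𝟙 b
𝟙-∨ true  b = s≤s z≤n
𝟙-∨ false b = ≤-refl

∑-mono-≤ : ∀ {n} {f g : Fin n → ℕ} → (∀ i → f i ≤ g i) → sum f ≤ sum g
∑-mono-≤ {zero}  f≤g = z≤n
∑-mono-≤ {suc n} f≤g = +-mono-≤ (f≤g Fin.zero) (∑-mono-≤ (f≤g ∘ Fin.suc))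

∑-const : ∀ n c → ∑[ i < n ] c ≡ n * c
∑-const zero    c = refl
∑-const (suc n) c = cong (c +_) (∑-const n c)

∑-splitAt : ∀ m {p} (f : Fin (m + p) → ℕ) → sum f ≡ ∑[ i < m ] f (i ↑ˡ p) + ∑[ j < p ] f (m ↑ʳ j)
∑-splitAt zero    f = refl
∑-splitAt (suc m) f =
  trans (cong (f Fin.zero +_) (∑-splitAt m (f ∘ Fin.suc))) (sym (+-assoc (f Fin.zero) _ _))

∣tabulate∣≡∑𝟙 : ∀ {n} (p : Fin n → Bool) → ∣ tabulate p ∣ ≡ ∑[ i < n ] 𝟙 (p i)
∣tabulate∣≡∑𝟙 {zero}  p = refl
∣tabulate∣≡∑𝟙 {suc n} p with p Fin.zero
... | true  = cong suc (∣tabulate∣≡∑𝟙 (p ∘ Fin.suc))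
... | false = ∣tabulate∣≡∑𝟙 (p ∘ Fin.suc)

∣∣≡∑𝟙 : ∀ {n} (S : Subset n) → ∣ S ∣ ≡ ∑[ i < n ] 𝟙 (Vec.lookup S i)
∣∣≡∑𝟙 S = trans (cong ∣_∣ (sym (tabulate∘lookup S))) (∣tabulate∣≡∑𝟙 (Vec.lookup S))

∑-lookup : ∀ {a} {A : Set a} (xs : List A) (f : A → ℕ) →
           ∑[ i < length xs ] f (lookup xs i) ≡ ListAction.sum (List.map f xs)
∑-lookup []       f = refl
∑-lookup (x ∷ xs) f = cong (f x +_) (∑-lookup xs f)

sum-map-filterᵇ : ∀ {a} {A : Set a} (p : A → Bool) (f : A → ℕ) xs →
                  ListAction.sum (List.map f (filterᵇ p xs)) ≡
                  ListAction.sum (List.map (λ x → 𝟙 (p x) * f x) xs)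
sum-map-filterᵇ p f []       = refl
sum-map-filterᵇ p f (x ∷ xs) with p x
... | true  = cong₂ _+_ (sym (+-identityʳ (f x))) (sum-map-filterᵇ p f xs)
... | false = sum-map-filterᵇ p f xs

sum-map-cartesianProduct : ∀ {a b} {A : Set a} {B : Set b} (f : A × B → ℕ) xs (ys : List B) →
  ListAction.sum (List.map f (cartesianProduct xs ys)) ≡
  ListAction.sum (List.map (λ x → ListAction.sum (List.map (λ y → f (x , y)) ys)) xs)
sum-map-cartesianProduct f []       ys = refl
sum-map-cartesianProduct f (x ∷ xs) ys = begin
  ListAction.sum (List.map f (List.map (x ,_) ys List.++ cartesianProduct xs ys))
    ≡⟨ cong ListAction.sum (map-++ f (List.map (x ,_) ys) _) ⟩
  ListAction.sum (List.map f (List.map (x ,_) ys) List.++ List.map f (cartesianProduct xs ys))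
    ≡⟨ sum-++ (List.map f (List.map (x ,_) ys)) _ ⟩
  ListAction.sum (List.map f (List.map (x ,_) ys)) + ListAction.sum (List.map f (cartesianProduct xs ys))
    ≡⟨ cong₂ _+_ (cong ListAction.sum (sym (map-∘ ys))) (sum-map-cartesianProduct f xs ys) ⟩
  ListAction.sum (List.map (λ y → f (x , y)) ys) +
  ListAction.sum (List.map (λ x → ListAction.sum (List.map (λ y → f (x , y)) ys)) xs) ∎
  where open ≡-Reasoning

sum-map-allFin : ∀ n (f : Fin n → ℕ) → ListAction.sum (List.map f (allFin n)) ≡ sum f
sum-map-allFin n f = trans (cong ListAction.sum (map-tabulate id f)) (sum-tabulate n f)
  where
  sum-tabulate : ∀ n (f : Fin n → ℕ) → ListAction.sum (List.tabulate f) ≡ sum f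
  sum-tabulate zero    f = refl
  sum-tabulate (suc n) f = cong (f Fin.zero +_) (sum-tabulate n (f ∘ Fin.suc))

injective⇒≤∣∣ : ∀ {k m} (S : Subset m) (w : Fin k → Fin m) →
                Injective _≡_ _≡_ w → (∀ i → w i ∈ S) → k ≤ ∣ S ∣
injective⇒≤∣∣ {zero}  S w inj w∈S = z≤n
injective⇒≤∣∣ {suc k} S w inj w∈S =
  ≤-trans (s≤s (injective⇒≤∣∣ (S - w Fin.zero) (w ∘ Fin.suc) (Finₚ.suc-injective ∘ inj) w∘suc∈))
          (x∈p⇒∣p-x∣<∣p∣ (w∈S Fin.zero))
  where
  w∘suc∈ : ∀ i → w (Fin.suc i) ∈ S - w Fin.zero
  w∘suc∈ i = x∈p∧x≢y⇒x∈p-y (w∈S (Fin.suc i)) (λ eq → Finₚ.0≢1+n (sym (inj eq)))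

covered⇒≤∣∣ : ∀ {a} {A : Set a} {k m} (S : Subset m) (f : Fin m → A) (g : Fin k → A) →
              Injective _≡_ _≡_ g → (∀ i → ∃[ x ] x ∈ S × f x ≡ g i) → k ≤ ∣ S ∣
covered⇒≤∣∣ S f g g-injective cover =
  injective⇒≤∣∣ S (proj₁ ∘ cover)
    (λ {i} {j} eq → g-injective (trans (sym (f-cover i)) (trans (cong f eq) (f-cover j))))
    (proj₁ ∘ proj₂ ∘ cover)
  where
  f-cover : ∀ i → f (proj₁ (cover i)) ≡ g i
  f-cover = proj₂ ∘ proj₂ ∘ cover

<ᵇ≡true⇒< : ∀ m n → (m <ᵇ n) ≡ true → m < n
<ᵇ≡true⇒< m n eq = <ᵇ⇒< m n (subst T (sym eq) tt)

<ᵇ≡false⇒≮ : ∀ m n → (m <ᵇ n) ≡ false → ¬ m < n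
<ᵇ≡false⇒≮ m n eq m<n = subst T eq (<⇒<ᵇ m<n)

≮⇒<ᵇ≡false : ∀ {m n} → ¬ m < n → (m <ᵇ n) ≡ false
≮⇒<ᵇ≡false {m} {n} m≮n with m <ᵇ n in m<ᵇn
... | true  = contradiction (<ᵇ≡true⇒< m n m<ᵇn) m≮n
... | false = refl

degree≤maxDegree : (G : Graph) (v : Fin (n G)) → degree G v ≤ maxDegree G
degree≤maxDegree G v =
  foldr-preservesᵒ (λ x y → [ m≤n⇒m≤n⊔o y , m≤n⇒m≤o⊔n x ]) 0 _
    (inj₂ (Any.map ≤-reflexive (∈-map⁺ (degree G) (∈-allFin v))))

maxDegree≤ : (G : Graph) {c : ℕ} → (∀ v → degree G v ≤ c) → maxDegree G ≤ c
maxDegree≤ G {c} deg≤c = foldr-preservesᵇ {P = _≤ c} ⊔-lub z≤n (All.map⁺ (tabulate⁺ deg≤c))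

∈N[]? : (H : Graph) (S : Subset (n H)) (u : Fin (n H)) → Dec (H ∈N[ S ] u)
∈N[]? H S u = (u ∈? S) ⊎-dec any? (λ s → (s ∈? S) ×-dec (adj H s u Boolₚ.≟ true))

isolating⇒dominates-endpoint : ∀ {H S u v} → IsIsolating H S → adj H u v ≡ true →
                               H ∈N[ S ] u ⊎ H ∈N[ S ] v
isolating⇒dominates-endpoint {H} {S} {u} {v} iso u~v with ∈N[]? H S u | ∈N[]? H S v
... | yes u∈N | _       = inj₁ u∈N
... | no _    | yes v∈N = inj₂ v∈N
... | no u∉N  | no v∉N  = contradiction (trans (sym u~v) (iso u v u∉N v∉N)) λ ()

module Edges (G : Graph) where

  E : List (Fin (n G) × Fin (n G))
  E = edges G

  pairs : List (Fin (n G) × Fin (n G))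
  pairs = cartesianProduct (allFin (n G)) (allFin (n G))

  isEdge : Fin (n G) × Fin (n G) → Bool
  isEdge (u , v) = (toℕ u <ᵇ toℕ v) ∧ adj G u v

  src tgt : Fin (length E) → Fin (n G)
  src e = proj₁ (lookup E e)
  tgt e = proj₂ (lookup E e)

  _∈ₑ_ : Fin (n G) → Fin (length E) → Set
  v ∈ₑ e = v ≡ src e ⊎ v ≡ tgt e

  edges-sound : ∀ e → toℕ (src e) < toℕ (tgt e) × adj G (src e) (tgt e) ≡ true
  edges-sound e with Equivalence.to T-∧ (proj₂ (∈-filter⁻ (T? ∘ isEdge) {xs = pairs} (∈-lookup e)))
  ... | src<tgt , src~tgt = <ᵇ⇒< _ _ src<tgt , Equivalence.to T-≡ src~tgt

  edges-complete : ∀ {u v} → toℕ u < toℕ v → adj G u v ≡ true → ∃[ e ] src e ≡ u × tgt e ≡ v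
  edges-complete {u} {v} u<v uv = Any.index uv∈E , sym (cong proj₁ uv≡e) , sym (cong proj₂ uv≡e)
    where
    uv∈E = ∈-filter⁺ (T? ∘ isEdge) (∈-cartesianProduct⁺ (∈-allFin u) (∈-allFin v))
             (Equivalence.from T-∧ (<⇒<ᵇ u<v , subst T (sym uv) tt))
    uv≡e = lookup-index uv∈E

  ∑-edges : (f : Fin (n G) × Fin (n G) → ℕ) →
            ∑[ e < length E ] f (lookup E e) ≡
            ∑[ u < n G ] ∑[ v < n G ] (𝟙 (isEdge (u , v)) * f (u , v))
  ∑-edges f = begin
    ∑[ e < length E ] f (lookup E e)
      ≡⟨ ∑-lookup E f ⟩
    ListAction.sum (List.map f E)
      ≡⟨ sum-map-filterᵇ isEdge f pairs ⟩
    ListAction.sum (List.map g pairs)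
      ≡⟨ sum-map-cartesianProduct g (allFin (n G)) (allFin (n G)) ⟩
    ListAction.sum (List.map (λ u → ListAction.sum (List.map (λ v → g (u , v)) (allFin (n G)))) (allFin (n G)))
      ≡⟨ sum-map-allFin (n G) _ ⟩
    ∑[ u < n G ] ListAction.sum (List.map (λ v → g (u , v)) (allFin (n G)))
      ≡⟨ sum-cong-≗ (λ u → sum-map-allFin (n G) (λ v → g (u , v))) ⟩
    ∑[ u < n G ] ∑[ v < n G ] g (u , v) ∎
    where
    open ≡-Reasoning
    g : Fin (n G) × Fin (n G) → ℕ
    g p = 𝟙 (isEdge p) * f p

  module _ (simple : IsSimple G) where

    isEdge-both-orientations : ∀ u v → 𝟙 (isEdge (u , v)) + 𝟙 (isEdge (v , u)) ≡ 𝟙 (adj G u v)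
    isEdge-both-orientations u v with toℕ u <ᵇ toℕ v in u<v | toℕ v <ᵇ toℕ u in v<u
    ... | true  | true  = contradiction (<ᵇ≡true⇒< (toℕ u) _ u<v) (<-asym (<ᵇ≡true⇒< (toℕ v) _ v<u))
    ... | true  | false = +-identityʳ _
    ... | false | true  = cong 𝟙 (proj₁ simple v u)
    ... | false | false = cong 𝟙 (sym (trans (cong (adj G u) (sym u≡v)) (proj₂ simple u)))
      where
      u≡v : u ≡ v
      u≡v = Finₚ.toℕ-injective (≤-antisym (≮⇒≥ (<ᵇ≡false⇒≮ (toℕ v) _ v<u))
                                           (≮⇒≥ (<ᵇ≡false⇒≮ (toℕ u) _ u<v)))

    ∑-isEdge-out+in≡degree : ∀ u →
      ∑[ v < n G ] 𝟙 (isEdge (u , v)) + ∑[ v < n G ] 𝟙 (isEdge (v , u)) ≡ degree G u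
    ∑-isEdge-out+in≡degree u = begin
      ∑[ v < n G ] 𝟙 (isEdge (u , v)) + ∑[ v < n G ] 𝟙 (isEdge (v , u))
        ≡⟨ ∑-distrib-+ (λ v → 𝟙 (isEdge (u , v))) (λ v → 𝟙 (isEdge (v , u))) ⟨
      ∑[ v < n G ] (𝟙 (isEdge (u , v)) + 𝟙 (isEdge (v , u)))
        ≡⟨ sum-cong-≗ (isEdge-both-orientations u) ⟩
      ∑[ v < n G ] 𝟙 (adj G u v)
        ≡⟨ ∣tabulate∣≡∑𝟙 (adj G u) ⟨
      degree G u ∎
      where open ≡-Reasoning

    handshake : (w : Fin (n G) → ℕ) →
                ∑[ e < length E ] (w (src e) + w (tgt e)) ≡ ∑[ u < n G ] (degree G u * w u)
    handshake w = begin
      ∑[ e < length E ] (w (src e) + w (tgt e))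
        ≡⟨ ∑-edges (λ (u , v) → w u + w v) ⟩
      ∑[ u < n G ] ∑[ v < n G ] (out u v * (w u + w v))
        ≡⟨ sum-cong-≗ (λ u → trans (sum-cong-≗ (λ v → *-distribˡ-+ (out u v) (w u) (w v)))
                                   (∑-distrib-+ (λ v → out u v * w u) (λ v → out u v * w v))) ⟩
      ∑[ u < n G ] (∑[ v < n G ] (out u v * w u) + ∑[ v < n G ] (out u v * w v))
        ≡⟨ ∑-distrib-+ (λ u → ∑[ v < n G ] (out u v * w u)) (λ u → ∑[ v < n G ] (out u v * w v)) ⟩
      ∑[ u < n G ] ∑[ v < n G ] (out u v * w u) + ∑[ u < n G ] ∑[ v < n G ] (out u v * w v)
        ≡⟨ cong₂ _+_ (sum-cong-≗ (λ u → sym (*-distribʳ-sum (w u) (out u))))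
                     (trans (∑-comm (λ u v → out u v * w v))
                            (sum-cong-≗ (λ v → sym (*-distribʳ-sum (w v) (λ u → out u v))))) ⟩
      ∑[ u < n G ] (∑[ v < n G ] out u v * w u) + ∑[ u < n G ] (∑[ v < n G ] out v u * w u)
        ≡⟨ ∑-distrib-+ (λ u → ∑[ v < n G ] out u v * w u) (λ u → ∑[ v < n G ] out v u * w u) ⟨
      ∑[ u < n G ] (∑[ v < n G ] out u v * w u + ∑[ v < n G ] out v u * w u)
        ≡⟨ sum-cong-≗ (λ u → trans (sym (*-distribʳ-+ (w u) (∑[ v < n G ] out u v) (∑[ v < n G ] out v u)))
                                   (cong (_* w u) (∑-isEdge-out+in≡degree u))) ⟩
      ∑[ u < n G ] (degree G u * w u) ∎
      where
      open ≡-Reasoning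
      out : Fin (n G) → Fin (n G) → ℕ
      out u v = 𝟙 (isEdge (u , v))

    adjacent⇒edge : ∀ {u v} → adj G u v ≡ true → ∃[ e ] u ∈ₑ e × v ∈ₑ e
    adjacent⇒edge {u} {v} uv with <-cmp (toℕ u) (toℕ v)
    ... | tri< u<v _ _ = let e , src≡u , tgt≡v = edges-complete u<v uv in
                         e , inj₁ (sym src≡u) , inj₂ (sym tgt≡v)
    ... | tri> _ _ v<u = let e , src≡v , tgt≡u = edges-complete v<u (trans (proj₁ simple v u) uv) in
                         e , inj₂ (sym tgt≡u) , inj₁ (sym src≡v)
    ... | tri≈ _ u≡v _ with Finₚ.toℕ-injective u≡v
    ...   | refl = contradiction (trans (sym uv) (proj₂ simple u)) λ ()

module MidGraph (G : Graph) where

  open Edges G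

  vtx : Fin (n G) → Fin (n (Mid G))
  vtx v = v ↑ˡ length E

  edg : Fin (length E) → Fin (n (Mid G))
  edg e = n G ↑ʳ e

  data MidVertex : Fin (n (Mid G)) → Set where
    vertex : ∀ v → MidVertex (vtx v)
    edge   : ∀ e → MidVertex (edg e)

  splitAt-vtx : ∀ v → splitAt (n G) (vtx v) ≡ inj₁ v
  splitAt-vtx v = Finₚ.splitAt-↑ˡ (n G) v (length E)

  splitAt-edg : ∀ e → splitAt (n G) (edg e) ≡ inj₂ e
  splitAt-edg e = Finₚ.splitAt-↑ʳ (n G) (length E) e

  midVertex : ∀ x → MidVertex x
  midVertex x with splitAt (n G) x in eq
  ... | inj₁ v = subst MidVertex (Finₚ.splitAt⁻¹-↑ˡ eq) (vertex v)
  ... | inj₂ e = subst MidVertex (Finₚ.splitAt⁻¹-↑ʳ eq) (edge e)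

  endpoint : Fin (n G) → Fin (length E) → Bool
  endpoint v e = ⌊ v ≟ src e ⌋ ∨ ⌊ v ≟ tgt e ⌋

  endpoint⁺ : ∀ {v e} → v ∈ₑ e → endpoint v e ≡ true
  endpoint⁺ {v} {e} (inj₁ v≡src) with v ≟ src e
  ... | yes _   = refl
  ... | no v≢src = contradiction v≡src v≢src
  endpoint⁺ {v} {e} (inj₂ v≡tgt) with v ≟ src e | v ≟ tgt e
  ... | yes _ | _       = refl
  ... | no _  | yes _   = refl
  ... | no _  | no v≢tgt = contradiction v≡tgt v≢tgt

  endpoint⁻ : ∀ {v e} → endpoint v e ≡ true → v ∈ₑ e
  endpoint⁻ {v} {e} v∈e with v ≟ src e | v ≟ tgt e
  ... | yes v≡src | _         = inj₁ v≡src
  ... | no _      | yes v≡tgt = inj₂ v≡tgt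
  ... | no _      | no _      = contradiction v∈e λ ()

  adj-vtx-vtx : ∀ u v → adj (Mid G) (vtx u) (vtx v) ≡ false
  adj-vtx-vtx u v rewrite splitAt-vtx u | splitAt-vtx v = refl

  adj-vtx-edg : ∀ v e → adj (Mid G) (vtx v) (edg e) ≡ endpoint v e
  adj-vtx-edg v e rewrite splitAt-vtx v | splitAt-edg e = refl

  adj-edg-vtx : ∀ e v → adj (Mid G) (edg e) (vtx v) ≡ endpoint v e
  adj-edg-vtx e v rewrite splitAt-edg e | splitAt-vtx v = refl

  adj-edg-edg : ∀ e f → adj (Mid G) (edg e) (edg f) ≡
                        not ⌊ e ≟ f ⌋ ∧ (endpoint (src e) f ∨ endpoint (tgt e) f)
  adj-edg-edg e f rewrite splitAt-edg e | splitAt-edg f = refl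

  vtx-adj-edg : ∀ {v e} → v ∈ₑ e → adj (Mid G) (vtx v) (edg e) ≡ true
  vtx-adj-edg {v} {e} v∈e = trans (adj-vtx-edg v e) (endpoint⁺ v∈e)

  edg-adj-edg : ∀ {e f t} → e ≢ f → t ∈ₑ e → t ∈ₑ f → adj (Mid G) (edg e) (edg f) ≡ true
  edg-adj-edg {e} {f} e≢f t∈e t∈f rewrite adj-edg-edg e f with e ≟ f | t∈e
  ... | yes e≡f | _        = contradiction e≡f e≢f
  ... | no _    | inj₁ refl = cong (_∨ endpoint (tgt e) f) (endpoint⁺ t∈f)
  ... | no _    | inj₂ refl = trans (cong (endpoint (src e) f ∨_) (endpoint⁺ t∈f)) (∨-zeroʳ _)

  edg-adj-edg⁻ : ∀ {e f} → adj (Mid G) (edg e) (edg f) ≡ true → ∃[ t ] t ∈ₑ e × t ∈ₑ f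
  edg-adj-edg⁻ {e} {f} e~f
    with Equivalence.to T-∨ (proj₂ (Equivalence.to T-∧ (Equivalence.from T-≡ (trans (sym (adj-edg-edg e f)) e~f))))
  ... | inj₁ src∈f = src e , inj₁ refl , endpoint⁻ (Equivalence.to T-≡ src∈f)
  ... | inj₂ tgt∈f = tgt e , inj₂ refl , endpoint⁻ (Equivalence.to T-≡ tgt∈f)

  adj-vtx⁻ : ∀ {x v} → adj (Mid G) x (vtx v) ≡ true → ∃[ e ] x ≡ edg e × v ∈ₑ e
  adj-vtx⁻ {x} {v} x~v with midVertex x
  ... | vertex u = contradiction (trans (sym x~v) (adj-vtx-vtx u v)) λ ()
  ... | edge e   = e , refl , endpoint⁻ (trans (sym (adj-edg-vtx e v)) x~v)

  adj-edg⁻ : ∀ {x e} → adj (Mid G) x (edg e) ≡ true →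
             (∃[ w ] x ≡ vtx w × w ∈ₑ e) ⊎ (∃[ f ] x ≡ edg f × ∃[ t ] t ∈ₑ f × t ∈ₑ e)
  adj-edg⁻ {x} {e} x~e with midVertex x
  ... | vertex w = inj₁ (w , refl , endpoint⁻ (trans (sym (adj-vtx-edg w e)) x~e))
  ... | edge f   = inj₂ (f , refl , edg-adj-edg⁻ x~e)

module IncidentEdges (G : Graph) (simple : IsSimple G) (S : Subset (n G)) where

  open Edges G
  open MidGraph G

  meets : Fin (length E) → Bool
  meets e = Vec.lookup S (src e) ∨ Vec.lookup S (tgt e)

  incident : Fin (n (Mid G)) → Bool
  incident x = [ (λ _ → false) , meets ]′ (splitAt (n G) x)

  incident-vtx : ∀ v → incident (vtx v) ≡ false
  incident-vtx v = cong [ (λ _ → false) , meets ]′ (splitAt-vtx v)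

  incident-edg : ∀ e → incident (edg e) ≡ meets e
  incident-edg e = cong [ (λ _ → false) , meets ]′ (splitAt-edg e)

  incidentEdges : Subset (n (Mid G))
  incidentEdges = tabulate incident

  meets⁺ : ∀ {s e} → s ∈ S → s ∈ₑ e → meets e ≡ true
  meets⁺ {e = e} s∈S (inj₁ refl) = cong (_∨ Vec.lookup S (tgt e)) ([]=⇒lookup s∈S)
  meets⁺ {e = e} s∈S (inj₂ refl) = trans (cong (Vec.lookup S (src e) ∨_) ([]=⇒lookup s∈S)) (∨-zeroʳ _)

  edg∈incidentEdges : ∀ {e} → meets e ≡ true → edg e ∈ incidentEdges
  edg∈incidentEdges {e} e-meets = lookup⇒[]= (edg e) incidentEdges
    (trans (lookup∘tabulate incident (edg e)) (trans (incident-edg e) e-meets))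

  edg-dominated : IsIsolating G S → ∀ e → Mid G ∈N[ incidentEdges ] edg e
  edg-dominated iso e with src e ∈? S | tgt e ∈? S
  ... | yes src∈S | _         = inj₁ (edg∈incidentEdges (meets⁺ src∈S (inj₁ refl)))
  ... | no _      | yes tgt∈S = inj₁ (edg∈incidentEdges (meets⁺ tgt∈S (inj₂ refl)))
  ... | no src∉S  | no tgt∉S  =
    inj₂ ([ via (inj₁ refl) , via (inj₂ refl) ]
            (isolating⇒dominates-endpoint iso (proj₂ (edges-sound e))))
    where
    endpoint∉S : ∀ {t} → t ∈ₑ e → t ∉ S
    endpoint∉S (inj₁ refl) = src∉S
    endpoint∉S (inj₂ refl) = tgt∉S
    via : ∀ {t} → t ∈ₑ e → G ∈N[ S ] t → ∃[ y ] y ∈ incidentEdges × adj (Mid G) y (edg e) ≡ true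
    via t∈e (inj₁ t∈S)             = contradiction t∈S (endpoint∉S t∈e)
    via t∈e (inj₂ (s , s∈S , s~t)) =
      let f , s∈f , t∈f = adjacent⇒edge simple s~t in
      edg f , edg∈incidentEdges (meets⁺ s∈S s∈f) ,
      edg-adj-edg (λ { refl → endpoint∉S s∈f s∈S }) t∈f t∈e

  incidentEdges-isolating : IsIsolating G S → IsIsolating (Mid G) incidentEdges
  incidentEdges-isolating iso x y x∉N y∉N with midVertex x | midVertex y
  ... | vertex u | vertex v = adj-vtx-vtx u v
  ... | edge e   | _        = contradiction (edg-dominated iso e) x∉N
  ... | vertex _ | edge e   = contradiction (edg-dominated iso e) y∉N

  ∣incidentEdges∣≤maxDegree*∣S∣ : ∣ incidentEdges ∣ ≤ maxDegree G * ∣ S ∣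
  ∣incidentEdges∣≤maxDegree*∣S∣ = begin
    ∣ incidentEdges ∣
      ≡⟨ ∣tabulate∣≡∑𝟙 incident ⟩
    ∑[ x < n (Mid G) ] 𝟙 (incident x)
      ≡⟨ ∑-splitAt (n G) (𝟙 ∘ incident) ⟩
    ∑[ v < n G ] 𝟙 (incident (vtx v)) + ∑[ e < length E ] 𝟙 (incident (edg e))
      ≡⟨ cong₂ _+_ (trans (sum-cong-≗ (cong 𝟙 ∘ incident-vtx)) (trans (∑-const (n G) 0) (*-zeroʳ (n G))))
                   (sum-cong-≗ (cong 𝟙 ∘ incident-edg)) ⟩
    ∑[ e < length E ] 𝟙 (meets e)
      ≤⟨ ∑-mono-≤ (λ e → 𝟙-∨ (Vec.lookup S (src e)) (Vec.lookup S (tgt e))) ⟩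
    ∑[ e < length E ] (s (src e) + s (tgt e))
      ≡⟨ handshake simple s ⟩
    ∑[ v < n G ] (degree G v * s v)
      ≤⟨ ∑-mono-≤ (λ v → *-monoˡ-≤ (s v) (degree≤maxDegree G v)) ⟩
    ∑[ v < n G ] (maxDegree G * s v)
      ≡⟨ *-distribˡ-sum (maxDegree G) s ⟨
    maxDegree G * sum s
      ≡⟨ cong (maxDegree G *_) (∣∣≡∑𝟙 S) ⟨
    maxDegree G * ∣ S ∣ ∎
    where
    open ≤-Reasoning
    s : Fin (n G) → ℕ
    s v = 𝟙 (Vec.lookup S v)

ι-Mid≤maxDegree*ι : (G : Graph) → IsSimple G → (a b : ℕ) → IsIota G a → IsIota (Mid G) b → b ≤ maxDegree G * a
ι-Mid≤maxDegree*ι G simple a b ((S , S-isolating , ∣S∣≡a) , _) (_ , b-minimal) = begin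
  b                       ≤⟨ b-minimal incidentEdges (incidentEdges-isolating S-isolating) ⟩
  ∣ incidentEdges ∣       ≤⟨ ∣incidentEdges∣≤maxDegree*∣S∣ ⟩
  maxDegree G * ∣ S ∣     ≡⟨ cong (maxDegree G *_) ∣S∣≡a ⟩
  maxDegree G * a         ∎
  where
  open ≤-Reasoning
  open IncidentEdges G simple S

⁅0⁆-isolating-K : ∀ k → IsIsolating (K (suc k)) ⁅ Fin.zero ⁆
⁅0⁆-isolating-K k u v u∉N v∉N with toℕ u <ᵇ suc k | toℕ v <ᵇ suc k
... | true  | true  = refl
... | false | _     = contradiction (inj₂ (Fin.zero , x∈⁅x⁆ Fin.zero , refl)) u∉N
... | true  | false = contradiction (inj₂ (Fin.zero , x∈⁅x⁆ Fin.zero , refl)) v∉N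

ι-K≤1 : ∀ k {a} → IsIota (K (suc k)) a → a ≤ 1
ι-K≤1 k {a} (_ , a-minimal) =
  subst (a ≤_) (∣⁅x⁆∣≡1 {suc k + suc k} Fin.zero) (a-minimal ⁅ Fin.zero ⁆ (⁅0⁆-isolating-K k))

module CompleteBipartite (k : ℕ) where

  open Edges (K k)
  open MidGraph (K k)

  side : Fin (k + k) → Bool
  side u = toℕ u <ᵇ k

  K-simple : IsSimple (K k)
  K-simple = (λ u v → xor-comm (side u) (side v)) , (λ v → xor-same (side v))

  left right : Fin k → Fin (k + k)
  left i = i ↑ˡ k
  right j = k ↑ʳ j

  left<k : ∀ i → toℕ (left i) < k
  left<k i = subst (_< k) (sym (Finₚ.toℕ-↑ˡ i k)) (Finₚ.toℕ<n i)

  k≤right : ∀ j → k ≤ toℕ (right j)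
  k≤right j = subst (k ≤_) (sym (Finₚ.toℕ-↑ʳ k j)) (m≤m+n k (toℕ j))

  side-left : ∀ i → side (left i) ≡ true
  side-left i = Equivalence.to T-≡ (<⇒<ᵇ (left<k i))

  side-right : ∀ j → side (right j) ≡ false
  side-right j = ≮⇒<ᵇ≡false (≤⇒≯ (k≤right j))

  degree-K : ∀ v → degree (K k) v ≡ k
  degree-K v = begin
    degree (K k) v
      ≡⟨ ∣tabulate∣≡∑𝟙 (adj (K k) v) ⟩
    ∑[ w < k + k ] 𝟙 (side v xor side w)
      ≡⟨ ∑-splitAt k (λ w → 𝟙 (side v xor side w)) ⟩
    ∑[ i < k ] 𝟙 (side v xor side (left i)) + ∑[ j < k ] 𝟙 (side v xor side (right j))
      ≡⟨ cong₂ _+_ (sum-cong-≗ (λ i → cong (λ b → 𝟙 (side v xor b)) (side-left i)))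
                   (sum-cong-≗ (λ j → cong (λ b → 𝟙 (side v xor b)) (side-right j))) ⟩
    ∑[ i < k ] 𝟙 (side v xor true) + ∑[ j < k ] 𝟙 (side v xor false)
      ≡⟨ cong₂ _+_ (∑-const k _) (∑-const k _) ⟩
    k * 𝟙 (side v xor true) + k * 𝟙 (side v xor false)
      ≡⟨ one-side-each (side v) ⟩
    k ∎
    where
    open ≡-Reasoning
    one-side-each : ∀ b → k * 𝟙 (b xor true) + k * 𝟙 (b xor false) ≡ k
    one-side-each true  = trans (cong (_+ k * 1) (*-zeroʳ k)) (*-identityʳ k)
    one-side-each false = trans (cong (k * 1 +_) (*-zeroʳ k)) (trans (+-identityʳ _) (*-identityʳ k))

  maxDegree-K≤k : maxDegree (K k) ≤ k
  maxDegree-K≤k = maxDegree≤ (K k) (≤-reflexive ∘ degree-K)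

  edge-sides : ∀ e → toℕ (src e) < k × k ≤ toℕ (tgt e)
  edge-sides e with edges-sound e
  ... | src<tgt , src~tgt with side (src e) in src-side | side (tgt e) in tgt-side
  ...   | true  | false = <ᵇ≡true⇒< _ k src-side , ≮⇒≥ (<ᵇ≡false⇒≮ _ k tgt-side)
  ...   | true  | true  = contradiction src~tgt λ ()
  ...   | false | false = contradiction src~tgt λ ()
  ...   | false | true  = contradiction (<-trans src<tgt (<ᵇ≡true⇒< _ k tgt-side))
                                        (≤⇒≯ (≮⇒≥ (<ᵇ≡false⇒≮ _ k src-side)))

  <k⇒≢tgt : ∀ {v} e → toℕ v < k → v ≢ tgt e
  <k⇒≢tgt e v<k refl = <⇒≱ v<k (proj₂ (edge-sides e))

  edge-between : ∀ i j → ∃[ e ] src e ≡ left i × tgt e ≡ right j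
  edge-between i j = edges-complete (<-≤-trans (left<k i) (k≤right j))
                                    (cong₂ _xor_ (side-left i) (side-right j))

  leftEnd rightEnd : Fin (n (Mid (K k))) → Fin (k + k)
  leftEnd x = [ id , src ]′ (splitAt (k + k) x)
  rightEnd x = [ id , tgt ]′ (splitAt (k + k) x)

  leftEnd-vtx : ∀ v → leftEnd (vtx v) ≡ v
  leftEnd-vtx v = cong [ id , src ]′ (splitAt-vtx v)

  leftEnd-edg : ∀ e → leftEnd (edg e) ≡ src e
  leftEnd-edg e = cong [ id , src ]′ (splitAt-edg e)

  rightEnd-vtx : ∀ v → rightEnd (vtx v) ≡ v
  rightEnd-vtx v = cong [ id , tgt ]′ (splitAt-vtx v)

  rightEnd-edg : ∀ e → rightEnd (edg e) ≡ tgt e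
  rightEnd-edg e = cong [ id , tgt ]′ (splitAt-edg e)

  dominated-vtx : ∀ {S i} → Mid (K k) ∈N[ S ] vtx (left i) → ∃[ x ] x ∈ S × leftEnd x ≡ left i
  dominated-vtx {i = i} (inj₁ a∈S) = vtx (left i) , a∈S , leftEnd-vtx (left i)
  dominated-vtx {i = i} (inj₂ (x , x∈S , x~a)) with adj-vtx⁻ x~a
  ... | e , refl , inj₁ a≡src = edg e , x∈S , trans (leftEnd-edg e) (sym a≡src)
  ... | e , refl , inj₂ a≡tgt = contradiction a≡tgt (<k⇒≢tgt e (left<k i))

  dominated-edg : ∀ {S e} → Mid (K k) ∈N[ S ] edg e →
                  ∃[ x ] x ∈ S × (leftEnd x ≡ src e ⊎ rightEnd x ≡ tgt e)
  dominated-edg {e = e} (inj₁ e∈S) = edg e , e∈S , inj₁ (leftEnd-edg e)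
  dominated-edg {e = e} (inj₂ (x , x∈S , x~e)) with adj-edg⁻ x~e
  ... | inj₁ (w , refl , inj₁ w≡src)    = vtx w , x∈S , inj₁ (trans (leftEnd-vtx w) w≡src)
  ... | inj₁ (w , refl , inj₂ w≡tgt)    = vtx w , x∈S , inj₂ (trans (rightEnd-vtx w) w≡tgt)
  ... | inj₂ (f , refl , t , t∈f , t∈e) = edg f , x∈S , shared-end t∈f t∈e
    where
    shared-end : ∀ {t f} → t ∈ₑ f → t ∈ₑ e → leftEnd (edg f) ≡ src e ⊎ rightEnd (edg f) ≡ tgt e
    shared-end {f = f} (inj₁ refl) (inj₁ t≡src) = inj₁ (trans (leftEnd-edg f) t≡src)
    shared-end {f = f} (inj₂ refl) (inj₂ t≡tgt) = inj₂ (trans (rightEnd-edg f) t≡tgt)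
    shared-end {f = f} (inj₁ refl) (inj₂ t≡tgt) =
      contradiction t≡tgt (<k⇒≢tgt e (proj₁ (edge-sides f)))
    shared-end {f = f} (inj₂ refl) (inj₁ t≡src) =
      contradiction (sym t≡src) (<k⇒≢tgt f (proj₁ (edge-sides e)))

  module _ {S : Subset (n (Mid (K k)))} (S-isolating : IsIsolating (Mid (K k)) S) where

    RowCovered ColumnCovered : Fin k → Set
    RowCovered i = ∃[ x ] x ∈ S × leftEnd x ≡ left i
    ColumnCovered j = ∃[ x ] x ∈ S × rightEnd x ≡ right j

    row-or-column-covered : ∀ i j → ¬ RowCovered i → ¬ ColumnCovered j → ⊥
    row-or-column-covered i j no-row no-column with edge-between i j
    ... | e , src≡left , tgt≡right =
      contradiction (trans (sym (vtx-adj-edg (inj₁ (sym src≡left))))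
                           (S-isolating (vtx (left i)) (edg e) (no-row ∘ dominated-vtx) edge-undominated))
                    (λ ())
      where
      edge-undominated : ¬ (Mid (K k) ∈N[ S ] edg e)
      edge-undominated e-dominated with dominated-edg e-dominated
      ... | x , x∈S , inj₁ ℓ≡src = no-row (x , x∈S , trans ℓ≡src src≡left)
      ... | x , x∈S , inj₂ r≡tgt = no-column (x , x∈S , trans r≡tgt tgt≡right)

    row-covered? : ∀ i → Dec (RowCovered i)
    row-covered? i = any? (λ x → (x ∈? S) ×-dec (leftEnd x ≟ left i))

    column-covered? : ∀ j → Dec (ColumnCovered j)
    column-covered? j = any? (λ x → (x ∈? S) ×-dec (rightEnd x ≟ right j))

    k≤∣S∣ : k ≤ ∣ S ∣
    k≤∣S∣ with all? row-covered?
    ... | yes rows = covered⇒≤∣∣ S leftEnd left (λ {i} {j} → Finₚ.↑ˡ-injective k i j) rows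
    ... | no not-all-rows with all? column-covered?
    ...   | yes columns     = covered⇒≤∣∣ S rightEnd right (λ {i} {j} → Finₚ.↑ʳ-injective k i j) columns
    ...   | no not-all-columns with ¬∀⟶∃¬ k RowCovered row-covered? not-all-rows
                                 | ¬∀⟶∃¬ k ColumnCovered column-covered? not-all-columns
    ...     | i , no-row | j , no-column = ⊥-elim (row-or-column-covered i j no-row no-column)

ι-Mid-K≡maxDegree*ι : (k : ℕ) → k ≥ 1 → (a b : ℕ) → IsIota (K k) a → IsIota (Mid (K k)) b → b ≡ maxDegree (K k) * a
ι-Mid-K≡maxDegree*ι k@(suc k′) _ a b ιa ιb@((S , S-isolating , ∣S∣≡b) , _) =
  ≤-antisym (ι-Mid≤maxDegree*ι (K k) K-simple a b ιa ιb) (begin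
    maxDegree (K k) * a   ≤⟨ *-mono-≤ maxDegree-K≤k (ι-K≤1 k′ ιa) ⟩
    k * 1                 ≡⟨ *-identityʳ k ⟩
    k                     ≤⟨ k≤∣S∣ S-isolating ⟩
    ∣ S ∣                 ≡⟨ ∣S∣≡b ⟩
    b                     ∎)
  where
  open ≤-Reasoning
  open CompleteBipartite k

proposition5 : ((G : Graph) → IsSimple G → (a b : ℕ) → IsIota G a → IsIota (Mid G) b → b ≤ maxDegree G * a)
    × ((k : ℕ) → k ≥ 1 → (a b : ℕ) → IsIota (K k) a → IsIota (Mid (K k)) b → b ≡ maxDegree (K k) * a)
proposition5 = ι-Mid≤maxDegree*ι , ι-Mid-K≡maxDegree*ι
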